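{- Suppose $h>h'$ are adjacent Hessenberg functions and $i_0$ is the index with $h_{i_0}=h'_{i_0}+1$. If $h_{i_0}=h'_k$ for some $k>i_0$, then $\mathfrak{C}_h\subset\mathfrak{C}_{h'}$.
   Context: A Hessenberg function is an $n$-tuple $h=(h_1,\ldots,h_n)$ of integers with $i\le h_i\le n$ for all $i$ and $h_i\le h_{i+1}$ for $1\le i\le n-1$. Hessenberg functions $h>h'$ are adjacent if there is $i_0$ with $h'_{i_0}=h_{i_0}-1$ and $h'_i=h_i$ for all $i\ne i_0$. For $S\subseteq\{1,\ldots,n\}$, $e_d(S)$ is the sum of all squarefree monomials of degree $d$ in $x_i$, $i\in S$ (with $e_0(S)=1$, $e_d(S)=0$ for $d<0$ or $d>|S|$), and $e_d(1,\ldots,m)$ means $S=\{1,\ldots,m\}$. $\mathfrak{C}_h=\{e_{h_i-r}(1,\ldots,h_i): 1\le i\le n,\ 0\le r\le i-1\}\subset\mathbb{Z}[x_1,\ldots,x_n]$. -}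

module Defs where

open import Data.Nat using (ℕ; zero; suc; _+_; _≤_; _<_; _≤?_; _∸_)
open import Data.Nat.Properties using (_≟_)
open import Data.Fin using (Fin; toℕ)
open import Data.Fin.Properties using (all?)
open import Data.Integer using (ℤ; +_)
open import Data.Product using (Σ; ∃; _×_)
open import Relation.Nullary using (¬_)
open import Relation.Nullary.Decidable using (_×-dec_; does)
open import Relation.Binary.PropositionalEquality using (_≡_)
open import Data.Bool using (if_then_else_)

-- Hessenberg functions on {1,…,n}, stored 0-based: position i : Fin n
-- stands for index (toℕ i + 1).
IsHessenberg : (n : ℕ) → (Fin n → ℕ) → Set
IsHessenberg n h =
  (∀ i → suc (toℕ i) ≤ h i) × (∀ i → h i ≤ n) ×
  (∀ i j → toℕ i < toℕ j → h i ≤ h j)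

-- Polynomials in ℤ[x_1,…,x_n] as coefficient functions on exponent vectors.
-- Variable position j : Fin n stands for x_{toℕ j + 1}.
Monomial : ℕ → Set
Monomial n = Fin n → ℕ

Poly : ℕ → Set
Poly n = Monomial n → ℤ

_≈P_ : ∀ {n} → Poly n → Poly n → Set
p ≈P q = ∀ α → p α ≡ q α

deg : ∀ {n} → Monomial n → ℕ
deg {zero} α = 0
deg {suc n} α = α Fin.zero + deg (λ j → α (Fin.suc j))

-- e_d(1,…,m) in ℤ[x_1,…,x_n]: the sum of all squarefree monomials of degree d
-- in the variables x_i, i ∈ {1,…,m}.
e : (n d m : ℕ) → Poly n
e n d m α =
  if does (all? (λ j → α j ≤? 1)
          ×-dec all? (λ j → (m ≤? toℕ j) →-dec (α j ≟ 0))
          ×-dec (deg α ≟ d))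
  then + 1 else + 0
  where
  open import Relation.Nullary.Decidable using (_→-dec_)

-- p ∈ C_h = { e_{h_i - r}(1,…,h_i) : 1 ≤ i ≤ n, 0 ≤ r ≤ i-1 }
_∈C_ : ∀ {n} → Poly n → (Fin n → ℕ) → Set
_∈C_ {n} p h = Σ (Fin n) λ i → Σ ℕ λ r → (r ≤ toℕ i) × (p ≈P e n (h i ∸ r) (h i))

_⊆C_ : ∀ {n} → (Fin n → ℕ) → (Fin n → ℕ) → Set
_⊆C_ {n} h h' = (p : Poly n) → p ∈C h → p ∈C h'

-- A generator e_{h_i - r}(1,…,h_i) of C_h depends only on the value h_i and
-- needs r ≤ i - 1. For i ≠ i₀ it is literally a generator of C_{h'}; for
-- i = i₀ the value h_{i₀} = h'_k recurs at the later position k, where the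
-- range of admissible r is larger.
module Submission where

open import Defs
open import Data.Nat using (ℕ; suc; _≤_; _<_; _∸_)
open import Data.Nat.Properties using (≤-trans; <⇒≤)
open import Data.Fin using (Fin; toℕ)
open import Data.Fin.Properties using () renaming (_≟_ to _≟F_)
open import Data.Product using (_,_)
open import Relation.Nullary using (¬_; yes; no)
open import Relation.Binary.PropositionalEquality using (_≡_; refl; sym)

generator∈C : ∀ {n} {h : Fin n → ℕ} {p : Poly n} {m r : ℕ} (j : Fin n) →
  r ≤ toℕ j → m ≡ h j → p ≈P e n (m ∸ r) m → p ∈C h
generator∈C {r = r} j r≤j refl p≈e = j , r , r≤j , p≈e

lemma4p11 : (n : ℕ) (h h' : Fin n → ℕ) →
    IsHessenberg n h → IsHessenberg n h' →
    (i₀ : Fin n) → suc (h' i₀) ≡ h i₀ → (∀ i → ¬ i ≡ i₀ → h' i ≡ h i) →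
    (k : Fin n) → toℕ i₀ < toℕ k → h i₀ ≡ h' k →
    h ⊆C h'
lemma4p11 n h h' _ _ i₀ _ agree k i₀<k hi₀≡h'k p (i , r , r≤i , p≈e) with i ≟F i₀
... | yes refl = generator∈C k (≤-trans r≤i (<⇒≤ i₀<k)) hi₀≡h'k p≈e
... | no i≢i₀ = generator∈C i r≤i (sym (agree i i≢i₀)) p≈e
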